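{- For a cardinal $\lambda$, the set of natural transformations $(\mathsf{P})^\lambda\to\mathsf{P}$ is in one-to-one correspondence with the set of non-increasing maps $2^\lambda\to2^\lambda$, where $2^\lambda$ carries the product order.
   Context: $\mathsf{P}:\mathbf{Set}\to\mathbf{Set}$ is the (covariant) powerset functor, sending $f$ to direct image. $(\mathsf{P})^\lambda$ is the $\lambda$-fold pointwise product functor $X\mapsto(\mathsf{P}X)^\lambda$. $2^\lambda$ is the set of $\lambda$-indexed families of elements of $\{0,1\}$ (equivalently subsets of $\lambda$), ordered componentwise. -}

module Defs where

open import Level using (0ℓ) renaming (suc to lsuc)
open import Data.Bool using (Bool) renaming (_≤_ to _≤ᵇ_)
open import Data.Product using (Σ; _×_; _,_)
open import Relation.Binary.PropositionalEquality as ≡ using (_≡_)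
open import Relation.Binary.Bundles using (Setoid)
open import Function.Bundles using (_⇔_)
import Function.Properties.Equivalence as ⇔

-- The covariant powerset functor P : Set → Set.
-- A subset of X is a predicate on X; two subsets are equal when they
-- have the same elements (extensional equality, pointwise ⇔).

Sub : Set → Set₁
Sub X = X → Set

_≐_ : {X : Set} → Sub X → Sub X → Set
S ≐ T = ∀ x → S x ⇔ T x

image : {X Y : Set} → (X → Y) → Sub X → Sub Y
image {X} f S y = Σ X λ x → S x × f x ≡ y

-- Natural transformations (P)^λ → P, where (P)^λ X = (P X)^λ.
-- λ is represented by an arbitrary index set L.
-- Components must respect equality of subsets (they are functions on
-- the set (P X)^λ), and the naturality square commutes.

record NatTrans (L : Set) : Set₁ where
  field
    α       : (X : Set) → (L → Sub X) → Sub X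
    α-cong  : (X : Set) (S T : L → Sub X) →
              (∀ i → S i ≐ T i) → α X S ≐ α X T
    natural : (X Y : Set) (f : X → Y) (S : L → Sub X) →
              image f (α X S) ≐ α Y (λ i → image f (S i))

NatTransSetoid : Set → Setoid (lsuc 0ℓ) (lsuc 0ℓ)
NatTransSetoid L = record
  { Carrier       = NatTrans L
  ; _≈_           = λ a b → (X : Set) (S : L → Sub X) →
                      NatTrans.α a X S ≐ NatTrans.α b X S
  ; isEquivalence = record
    { refl  = λ X S x → ⇔.refl
    ; sym   = λ p X S x → ⇔.sym (p X S x)
    ; trans = λ p q X S x → ⇔.trans (p X S x) (q X S x)
    }
  }

-- 2^λ : λ-indexed families in {0,1} (Bool, false < true), ordered
-- componentwise.

Two^ : Set → Set
Two^ L = L → Bool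

_≤₂_ : {L : Set} → Two^ L → Two^ L → Set
x ≤₂ y = ∀ i → x i ≤ᵇ y i

_≈₂_ : {L : Set} → Two^ L → Two^ L → Set
x ≈₂ y = ∀ i → x i ≡ y i

record NonIncMap (L : Set) : Set where
  field
    g       : Two^ L → Two^ L
    g-cong  : ∀ x y → x ≈₂ y → g x ≈₂ g y
    non-inc : ∀ x → g x ≤₂ x

NonIncSetoid : Set → Setoid 0ℓ 0ℓ
NonIncSetoid L = record
  { Carrier       = NonIncMap L
  ; _≈_           = λ a b → ∀ x → NonIncMap.g a x ≈₂ NonIncMap.g b x
  ; isEquivalence = record
    { refl  = λ x i → ≡.refl
    ; sym   = λ p x i → ≡.sym (p x i)
    ; trans = λ p q x i → ≡.trans (p x i) (q x i)
    }
  }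

-- Naturality forces a transformation α to treat points that lie in exactly the
-- same members of a family alike (swap two such points), and a point lying in
-- no member can be sent to a fresh point, so α_X(S) ⊆ ⋃ S.  Hence α_X(S) is a
-- union of some of the S_j.  Which j occur depends only on which S_i are
-- nonempty: tagging S as the family {i} × S_i on L × X and projecting to either
-- factor gives α_X(S) = ⋃ { S_j | j ∈ α_L(δ e) }, where e ∈ 2^λ records the
-- nonempty S_i (occupied S) and δ e is the family i ↦ {i} if e_i, ∅ otherwise
-- (singletonsOn e).  So α is determined by g(e) = α_L(δ e) ∈ 2^λ, and
-- α_L(δ e) ⊆ ⋃ δ e gives g(e) ≤ e.
module Submission where

open import Defs
open import Level using (0ℓ)
open import Axiom.ExcludedMiddle using (ExcludedMiddle)
open import Function.Bundles using (Inverse; _⇔_; mk⇔; Equivalence)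
import Function.Properties.Equivalence as ⇔
open import Data.Bool using (Bool; true; false; b≤b; f≤t) renaming (_≤_ to _≤ᵇ_)
open import Data.Bool.Properties using (T-≡; ≤-minimum)
open import Data.Product using (Σ; _×_; _,_; proj₁; proj₂)
open import Data.Sum using (_⊎_; inj₁; inj₂)
open import Data.Sum.Properties using (inj₁-injective)
open import Data.Unit using (⊤; tt)
open import Data.Empty using (⊥-elim)
open import Relation.Nullary using (¬_; yes; no; does)
open import Relation.Nullary.Decidable using (dec-true; does-⇔; decidable-stable; T?)
open import Relation.Binary.Bundles using (Setoid)
open import Relation.Binary.Definitions using (DecidableEquality)
open import Relation.Binary.PropositionalEquality using (_≡_; refl; sym; trans; cong; subst)

open Equivalence using (to; from)

_≈ᴺ_ : {L : Set} → NatTrans L → NatTrans L → Set₁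
_≈ᴺ_ {L} = Setoid._≈_ (NatTransSetoid L)

_≈ᴳ_ : {L : Set} → NonIncMap L → NonIncMap L → Set
_≈ᴳ_ {L} = Setoid._≈_ (NonIncSetoid L)

≤ᵇ-fromImplication : ∀ {a b} → (a ≡ true → b ≡ true) → a ≤ᵇ b
≤ᵇ-fromImplication {false} {b} _ = ≤-minimum b
≤ᵇ-fromImplication {true}  a⇒b rewrite a⇒b refl = b≤b

≤ᵇ-preserves-true : ∀ {a b} → a ≤ᵇ b → a ≡ true → b ≡ true
≤ᵇ-preserves-true b≤b a≡true = a≡true
≤ᵇ-preserves-true f≤t _      = refl

module Transposition {Z : Set} (_≟_ : DecidableEquality Z) (a b : Z) where

  swap : Z → Z
  swap z with z ≟ a | z ≟ b
  ... | yes _ | _     = b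
  ... | no _  | yes _ = a
  ... | no _  | no _  = z

  data SwapView (z : Z) (swap-z : Z) : Set where
    at-a  : z ≡ a → swap-z ≡ b → SwapView z swap-z
    at-b  : z ≡ b → swap-z ≡ a → SwapView z swap-z
    fixed : swap-z ≡ z → SwapView z swap-z

  swap-view : ∀ z → SwapView z (swap z)
  swap-view z with z ≟ a | z ≟ b
  ... | yes z≡a | _       = at-a z≡a refl
  ... | no _    | yes z≡b = at-b z≡b refl
  ... | no _    | no _    = fixed refl

  swap-a : swap a ≡ b
  swap-a with a ≟ a | a ≟ b
  ... | yes _ | _     = refl
  ... | no a≢a | _    = ⊥-elim (a≢a refl)

  swap-b : swap b ≡ a
  swap-b with b ≟ a | b ≟ b
  ... | yes b≡a | _      = b≡a
  ... | no _    | yes _  = refl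
  ... | no _    | no b≢b = ⊥-elim (b≢b refl)

  swap-involutive : ∀ z → swap (swap z) ≡ z
  swap-involutive z with swap-view z
  ... | at-a z≡a e = trans (cong swap e) (trans swap-b (sym z≡a))
  ... | at-b z≡b e = trans (cong swap e) (trans swap-a (sym z≡b))
  ... | fixed e    = trans (cong swap e) e

  swap-preserves : (P : Sub Z) → P a ⇔ P b → ∀ {z} → P z → P (swap z)
  swap-preserves P Pa⇔Pb {z} Pz with swap-view z
  ... | at-a z≡a e = subst P (sym e) (to Pa⇔Pb (subst P z≡a Pz))
  ... | at-b z≡b e = subst P (sym e) (from Pa⇔Pb (subst P z≡b Pz))
  ... | fixed e    = subst P (sym e) Pz

  image-swap : (P : Sub Z) → P a ⇔ P b → image swap P ≐ P
  image-swap P Pa⇔Pb z = mk⇔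
    (λ { (w , Pw , swap-w≡z) → subst P swap-w≡z (swap-preserves P Pa⇔Pb Pw) })
    (λ Pz → swap z , swap-preserves P Pa⇔Pb Pz , swap-involutive z)

tagged : {L X : Set} → (L → Sub X) → L → Sub (L × X)
tagged S i (k , x) = i ≡ k × S i x

image-proj₂-tagged : {L X : Set} (S : L → Sub X) → ∀ i → image proj₂ (tagged S i) ≐ S i
image-proj₂-tagged S i x = mk⇔
  (λ { ((_ , y) , (refl , Sy) , refl) → Sy })
  (λ Sx → (i , x) , (refl , Sx) , refl)

tagged-fibre : {L X : Set} (S : L → Sub X) {j : L} {x y : X} →
               S j x → S j y → ∀ i → tagged S i (j , x) ⇔ tagged S i (j , y)
tagged-fibre S Sx Sy i = mk⇔ (λ { (refl , _) → refl , Sy }) (λ { (refl , _) → refl , Sx })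

singletonsOn : {L : Set} → Two^ L → L → Sub L
singletonsOn e i k = e i ≡ true × i ≡ k

singletonsOn-cong : {L : Set} {e e′ : Two^ L} → e ≈₂ e′ → ∀ i → singletonsOn e i ≐ singletonsOn e′ i
singletonsOn-cong e≈e′ i k = mk⇔ (λ { (eᵢ , i≡k) → trans (sym (e≈e′ i)) eᵢ , i≡k })
                                 (λ { (e′ᵢ , i≡k) → trans (e≈e′ i) e′ᵢ , i≡k })

module _ {L : Set} (N : NatTrans L) where
  open NatTrans N

  natural-≐ : {X Y : Set} (f : X → Y) (S : L → Sub X) (T : L → Sub Y) →
              (∀ i → image f (S i) ≐ T i) → image f (α X S) ≐ α Y T
  natural-≐ {X} {Y} f S T fS≐T y = ⇔.trans (natural X Y f S y) (α-cong Y _ T fS≐T y)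

module Classical (em : ExcludedMiddle 0ℓ) where

  ⌊_⌋ : Set → Bool
  ⌊ P ⌋ = does (em {P})

  ⌊⌋-sound : {P : Set} → ⌊ P ⌋ ≡ true → P
  ⌊⌋-sound {P} ⌊P⌋≡true with em {P}
  ... | yes p = p
  ... | no _ with () ← ⌊P⌋≡true

  ⌊⌋-true⇔ : {P : Set} → ⌊ P ⌋ ≡ true ⇔ P
  ⌊⌋-true⇔ = mk⇔ ⌊⌋-sound (dec-true em)

  ⌊⌋-cong : {P Q : Set} → P ⇔ Q → ⌊ P ⌋ ≡ ⌊ Q ⌋
  ⌊⌋-cong P⇔Q = does-⇔ P⇔Q em em

  ⌊≡true⌋ : (b : Bool) → ⌊ b ≡ true ⌋ ≡ b
  ⌊≡true⌋ b = does-⇔ (⇔.sym T-≡) em (T? b)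

  occupied : {L X : Set} → (L → Sub X) → Two^ L
  occupied {X = X} S i = ⌊ Σ X (S i) ⌋

  occupied-cong : {L X : Set} {S T : L → Sub X} → (∀ i → S i ≐ T i) → occupied S ≈₂ occupied T
  occupied-cong S≐T i = ⌊⌋-cong (mk⇔ (λ { (x , Sx) → x , to (S≐T i x) Sx })
                                     (λ { (x , Tx) → x , from (S≐T i x) Tx }))

  occupied-image : {L X Y : Set} (f : X → Y) (S : L → Sub X) →
                   occupied S ≈₂ occupied (λ i → image f (S i))
  occupied-image f S i = ⌊⌋-cong (mk⇔ (λ { (x , Sx) → f x , x , Sx , refl })
                                      (λ { (_ , x , Sx , _) → x , Sx }))

  occupied-singletonsOn : {L : Set} (e : Two^ L) → occupied (singletonsOn e) ≈₂ e
  occupied-singletonsOn e i =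
    trans (⌊⌋-cong (mk⇔ (λ { (_ , eᵢ , _) → eᵢ }) (λ eᵢ → i , eᵢ , refl))) (⌊≡true⌋ (e i))

  image-proj₁-tagged : {L X : Set} (S : L → Sub X) →
                       ∀ i → image proj₁ (tagged S i) ≐ singletonsOn (occupied S) i
  image-proj₁-tagged S i k = mk⇔
    (λ { ((_ , x) , (refl , Sx) , refl) → from ⌊⌋-true⇔ (x , Sx) , refl })
    (λ { (occ , refl) → let (x , Sx) = to ⌊⌋-true⇔ occ in (i , x) , (refl , Sx) , refl })

  module _ {L : Set} (N : NatTrans L) where
    open NatTrans N

    α-respects-fibres : {X : Set} (S : L → Sub X) {a b : X} →
                        (∀ i → S i a ⇔ S i b) → α X S a → α X S b
    α-respects-fibres {X} S {a} {b} a∼b αa =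
      to (natural-≐ N swap S S (λ i → image-swap (S i) (a∼b i)) b) (a , αa , swap-a)
      where open Transposition {X} (λ _ _ → em) a b

    α-support : {X : Set} (S : L → Sub X) {x : X} → α X S x → Σ L λ i → S i x
    α-support {X} S {x} αx = decidable-stable em λ x∉⋃S →
      no-fresh-point (from (α-inj₁ (inj₂ tt))
        (α-respects-fibres S⁺ (fresh-fibre x∉⋃S) (to (α-inj₁ (inj₁ x)) (x , αx , refl))))
      where
        S⁺ : L → Sub (X ⊎ ⊤)
        S⁺ i = image inj₁ (S i)
        α-inj₁ : image inj₁ (α X S) ≐ α (X ⊎ ⊤) S⁺
        α-inj₁ = natural-≐ N inj₁ S S⁺ (λ i y → ⇔.refl)
        no-fresh-point : {P : Sub X} → ¬ image inj₁ P (inj₂ tt)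
        no-fresh-point (_ , _ , ())
        fresh-fibre : ¬ (Σ L λ i → S i x) → ∀ i → S⁺ i (inj₁ x) ⇔ S⁺ i (inj₂ tt)
        fresh-fibre x∉⋃S i = mk⇔
          (λ { (y , Sy , y≡x) → ⊥-elim (x∉⋃S (i , subst (S i) (inj₁-injective y≡x) Sy)) })
          (λ fresh → ⊥-elim (no-fresh-point fresh))

    α-tagged : {X : Set} (S : L → Sub X) {z : L × X} → α (L × X) (tagged S) z → S (proj₁ z) (proj₂ z)
    α-tagged S αz with α-support (tagged S) αz
    ... | _ , refl , Sx = Sx

    α-representation : {X : Set} (S : L → Sub X) (x : X) →
                       α X S x ⇔ Σ L λ j → α L (singletonsOn (occupied S)) j × S j x
    α-representation {X} S x = mk⇔ union⁺ union⁻
      where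
        α-proj₁ : image proj₁ (α (L × X) (tagged S)) ≐ α L (singletonsOn (occupied S))
        α-proj₁ = natural-≐ N proj₁ (tagged S) _ (image-proj₁-tagged S)
        α-proj₂ : image proj₂ (α (L × X) (tagged S)) ≐ α X S
        α-proj₂ = natural-≐ N proj₂ (tagged S) S (image-proj₂-tagged S)
        union⁺ : α X S x → Σ L λ j → α L (singletonsOn (occupied S)) j × S j x
        union⁺ αx with from (α-proj₂ x) αx
        ... | (j , _) , αz , refl = j , to (α-proj₁ j) (_ , αz , refl) , α-tagged S αz
        union⁻ : (Σ L λ j → α L (singletonsOn (occupied S)) j × S j x) → α X S x
        union⁻ (j , αj , Sx) with from (α-proj₁ j) αj
        ... | _ , αz , refl = to (α-proj₂ x) (_ , α-respects-fibres (tagged S) same-fibre αz , refl)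
          where same-fibre = tagged-fibre S (α-tagged S αz) Sx

  toNonInc : {L : Set} → NatTrans L → NonIncMap L
  toNonInc {L} N = record { g = g ; g-cong = g-cong ; non-inc = non-inc }
    where
      open NatTrans N
      g : Two^ L → Two^ L
      g e j = ⌊ α L (singletonsOn e) j ⌋
      g-cong : ∀ e e′ → e ≈₂ e′ → g e ≈₂ g e′
      g-cong e e′ e≈e′ j = ⌊⌋-cong (α-cong L _ _ (singletonsOn-cong e≈e′) j)
      non-inc : ∀ e → g e ≤₂ e
      non-inc e j =
        ≤ᵇ-fromImplication λ gej → covered (α-support N (singletonsOn e) (to ⌊⌋-true⇔ gej))
        where
          covered : Σ L (λ i → singletonsOn e i j) → e j ≡ true
          covered (_ , eᵢ , refl) = eᵢ

  toNatTrans : {L : Set} → NonIncMap L → NatTrans L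
  toNatTrans {L} G = record { α = α ; α-cong = α-cong ; natural = natural }
    where
      open NonIncMap G
      α : (X : Set) → (L → Sub X) → Sub X
      α X S x = Σ L λ j → g (occupied S) j ≡ true × S j x
      α-cong : (X : Set) (S T : L → Sub X) → (∀ i → S i ≐ T i) → α X S ≐ α X T
      α-cong X S T S≐T x = mk⇔
        (λ { (j , gj , Sx) → j , trans (sym (gS≈gT j)) gj , to (S≐T j x) Sx })
        (λ { (j , gj , Tx) → j , trans (gS≈gT j) gj , from (S≐T j x) Tx })
        where gS≈gT = g-cong _ _ (occupied-cong S≐T)
      natural : (X Y : Set) (f : X → Y) (S : L → Sub X) → image f (α X S) ≐ α Y (λ i → image f (S i))
      natural X Y f S y = mk⇔
        (λ { (x , (j , gj , Sx) , fx≡y) → j , trans (sym (gS≈gfS j)) gj , x , Sx , fx≡y })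
        (λ { (j , gj , x , Sx , fx≡y) → x , (j , trans (gS≈gfS j) gj , Sx) , fx≡y })
        where gS≈gfS = g-cong _ _ (occupied-image f S)

  toNonInc-cong : {L : Set} (N N′ : NatTrans L) → N ≈ᴺ N′ → toNonInc N ≈ᴳ toNonInc N′
  toNonInc-cong {L} _ _ N≈N′ e j = ⌊⌋-cong (N≈N′ L (singletonsOn e) j)

  toNatTrans-cong : {L : Set} (G G′ : NonIncMap L) → G ≈ᴳ G′ → toNatTrans G ≈ᴺ toNatTrans G′
  toNatTrans-cong _ _ G≈G′ X S x = mk⇔
    (λ { (j , gj , Sx) → j , trans (sym (G≈G′ (occupied S) j)) gj , Sx })
    (λ { (j , g′j , Sx) → j , trans (G≈G′ (occupied S) j) g′j , Sx })

  toNonInc-toNatTrans : {L : Set} (G : NonIncMap L) → toNonInc (toNatTrans G) ≈ᴳ G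
  toNonInc-toNatTrans {L} G e j = trans (⌊⌋-cong (mk⇔ α⇒g α⇐g)) (⌊≡true⌋ (g e j))
    where
      open NonIncMap G
      open NatTrans (toNatTrans G)
      gδe≈ge : g (occupied (singletonsOn e)) ≈₂ g e
      gδe≈ge = g-cong _ _ (occupied-singletonsOn e)
      α⇒g : α L (singletonsOn e) j → g e j ≡ true
      α⇒g (k , gk , _ , refl) = trans (sym (gδe≈ge k)) gk
      α⇐g : g e j ≡ true → α L (singletonsOn e) j
      α⇐g gj = j , trans (gδe≈ge j) gj , ≤ᵇ-preserves-true (non-inc e j) gj , refl

  toNatTrans-toNonInc : {L : Set} (N : NatTrans L) → toNatTrans (toNonInc N) ≈ᴺ N
  toNatTrans-toNonInc N X S x = ⇔.trans
    (mk⇔ (λ { (j , gj , Sx) → j , to ⌊⌋-true⇔ gj , Sx })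
         (λ { (j , αj , Sx) → j , from ⌊⌋-true⇔ αj , Sx }))
    (⇔.sym (α-representation N S x))

  toNonInc-inverse : {L : Set} (G : NonIncMap L) (N : NatTrans L) → N ≈ᴺ toNatTrans G → toNonInc N ≈ᴳ G
  toNonInc-inverse G N N≈G e j =
    trans (toNonInc-cong N (toNatTrans G) N≈G e j) (toNonInc-toNatTrans G e j)

  toNatTrans-inverse : {L : Set} (N : NatTrans L) (G : NonIncMap L) → G ≈ᴳ toNonInc N → toNatTrans G ≈ᴺ N
  toNatTrans-inverse N G G≈N X S x =
    ⇔.trans (toNatTrans-cong G (toNonInc N) G≈N X S x) (toNatTrans-toNonInc N X S x)

theorem4p13 : (L : Set) → ExcludedMiddle 0ℓ →
    Inverse (NatTransSetoid L) (NonIncSetoid L)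
theorem4p13 L em = record
  { to        = toNonInc
  ; from      = toNatTrans
  ; to-cong   = λ {N N′} → toNonInc-cong N N′
  ; from-cong = λ {G G′} → toNatTrans-cong G G′
  ; inverse   = (λ {G N} → toNonInc-inverse G N) , (λ {N G} → toNatTrans-inverse N G)
  }
  where open Classical em
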